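{- Let $q,r$ be distinct odd primes, $\alpha,\beta,\gamma\geq 1$ integers, and $\Gamma=\mathrm{Cay}(\mathbb{Z}_{2}\times\mathbb{Z}_{2^{\alpha}q^{\beta}r^{\gamma}},\Phi)$ with $\Phi=\varphi_2\times\varphi_{2^{\alpha}q^{\beta}r^{\gamma}}$. Then $\mathrm{diam}(\Gamma)=3$.
   Context: For $n\geq 1$, $\mathbb{Z}_n=\{0,\dots,n-1\}$ is the integers mod $n$ and $\varphi_n$ is the set of elements of $\mathbb{Z}_n$ coprime to $n$. $\mathrm{Cay}(\mathbb{Z}_p\times\mathbb{Z}_m,\varphi_p\times\varphi_m)$ is the graph on $\mathbb{Z}_p\times\mathbb{Z}_m$ where $(u,v)\sim(u',v')$ iff $u-u'\in\varphi_p$ and $v-v'\in\varphi_m$. The diameter of a disconnected graph is, by convention, the maximum of the diameters of its connected components. -}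

module Defs where

open import Data.Nat using (ℕ; zero; suc; _+_; _∸_; _≤_; _<_; _≤?_)
open import Data.Nat.Coprimality using (Coprime)
open import Data.Fin using (Fin; toℕ)
open import Data.Product using (Σ; ∃; _×_; _,_)
open import Relation.Nullary using (¬_; yes; no)

subMod : (n : ℕ) → Fin n → Fin n → ℕ
subMod n a b with toℕ b ≤? toℕ a
... | yes _ = toℕ a ∸ toℕ b
... | no  _ = (n + toℕ a) ∸ toℕ b

InPhi : (n : ℕ) → ℕ → Set
InPhi n x = Coprime x n

record Graph : Set₁ where
  field
    V   : Set
    Adj : V → V → Set

open Graph public

UnitaryCayley : ℕ → ℕ → Graph
UnitaryCayley p m = record
  { V   = Fin p × Fin m
  ; Adj = λ { (u , v) (u' , v') → InPhi p (subMod p u u') × InPhi m (subMod m v v') }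
  }

data Walk (G : Graph) : ℕ → V G → V G → Set where
  here : ∀ {x} → Walk G zero x x
  step : ∀ {k x y z} → Adj G x y → Walk G k y z → Walk G (suc k) x z

Connected : (G : Graph) → V G → V G → Set
Connected G x y = ∃ λ k → Walk G k x y

DistLe : (G : Graph) → V G → V G → ℕ → Set
DistLe G x y d = ∃ λ k → k ≤ d × Walk G k x y

-- diam(G) = d : maximum of d(x,y) over pairs x,y in the same connected component
-- (= maximum of the diameters of the components).
HasDiameter : Graph → ℕ → Set
HasDiameter G d =
  ((x y : V G) → Connected G x y → DistLe G x y d)
  × (Σ (V G) λ x → Σ (V G) λ y → Connected G x y × ((k : ℕ) → k < d → ¬ Walk G k x y))

-- Every edge changes the first coordinate and, n being even, the parity of the second, so the
-- parity of u + v is constant on components. Two vertices (u , v), (u , v') of one component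
-- are joined through (ū , w) as soon as w - v and w - v' are units of ℤ_n: take w ≡ v + 1
-- (mod 2), and for each odd prime p ∣ n one of three candidates spaced by a number prime to p
-- avoids the two forbidden residues mod p. Vertices (u , v), (ū , v') are joined through
-- (ū , v + 1). Finally (1 , q) and (0 , 0) lie in one component at distance exactly 3: q is not
-- a unit of ℤ_n, and a walk of length 2 returns to its first coordinate.
module Submission where

open import Defs
open import Data.Nat using (ℕ; zero; suc; _+_; s≤s; _*_; _^_; _≤_; _<_; z≤n; _≟_; _≤?_; NonZero; ≢-nonZero; ≢-nonZero⁻¹)
open import Data.Nat.Properties using (+-assoc; +-comm; +-identityʳ; +-cancelˡ-≡; m+[n∸m]≡n; m≤m+n; ≤-trans; <⇒≤; m*n≢0; m^n≢0; ≤-refl)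
open import Data.Nat.DivMod
open import Data.Nat.Divisibility
open import Data.Nat.Primality using (Prime; prime⇒irreducible; euclidsLemma; ¬prime[1]; prime[2]; prime⇒nonZero)
open import Data.Nat.Coprimality using (Coprime; coprime-divisor; 1-coprimeTo)
open import Data.Fin using (Fin; zero; suc; toℕ)
open import Data.Fin.Properties using (toℕ<n; toℕ-fromℕ<)
open import Data.Product using (Σ; ∃; _×_; _,_; proj₁; proj₂)
open import Data.Sum using (_⊎_; inj₁; inj₂)
open import Function using (_∘_)
open import Relation.Nullary using (¬_; yes; no; contradiction)
open import Relation.Binary.PropositionalEquality

∤⇒coprime : ∀ {p s} → Prime p → ¬ p ∣ s → Coprime s p
∤⇒coprime p-prime p∤s (d∣s , d∣p) with prime⇒irreducible p-prime d∣p
... | inj₁ d≡1 = d≡1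
... | inj₂ refl = contradiction d∣s p∤s

coprime-*ʳ : ∀ {s a b} → Coprime s a → Coprime s b → Coprime s (a * b)
coprime-*ʳ {s} {a} s⊥a s⊥b {d} (d∣s , d∣ab) = s⊥b (d∣s , coprime-divisor d⊥a d∣ab)
  where
  d⊥a : Coprime d a
  d⊥a (e∣d , e∣a) = s⊥a (∣-trans e∣d d∣s , e∣a)

coprime-^ʳ : ∀ {s p} k → Coprime s p → Coprime s (p ^ k)
coprime-^ʳ zero    _   (_ , d∣1) = ∣1⇒≡1 d∣1
coprime-^ʳ (suc k) s⊥p = coprime-*ʳ s⊥p (coprime-^ʳ k s⊥p)

prime≢1 : ∀ {p} → Prime p → p ≢ 1
prime≢1 p-prime refl = ¬prime[1] p-prime

prime∤prime : ∀ {p q} → Prime p → Prime q → p ≢ q → ¬ p ∣ q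
prime∤prime p-prime q-prime p≢q p∣q with prime⇒irreducible q-prime p∣q
... | inj₁ p≡1 = prime≢1 p-prime p≡1
... | inj₂ p≡q = p≢q p≡q

prime∤* : ∀ {p a b} → Prime p → ¬ p ∣ a → ¬ p ∣ b → ¬ p ∣ a * b
prime∤* {a = a} {b} p-prime p∤a p∤b p∣ab with euclidsLemma a b p-prime p∣ab
... | inj₁ p∣a = p∤a p∣a
... | inj₂ p∣b = p∤b p∣b

prime∤^ : ∀ {p m} k → Prime p → ¬ p ∣ m → ¬ p ∣ m ^ k
prime∤^ zero    p-prime _   p∣1 = prime≢1 p-prime (∣1⇒≡1 p∣1)
prime∤^ (suc k) p-prime p∤m = prime∤* p-prime p∤m (prime∤^ k p-prime p∤m)

odd-prime∤2 : ∀ {p} → Prime p → ¬ 2 ∣ p → ¬ p ∣ 2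
odd-prime∤2 p-prime 2∤p = prime∤prime p-prime prime[2] λ { refl → 2∤p ∣-refl }

m∣m^n : ∀ m {n} → 1 ≤ n → m ∣ m ^ n
m∣m^n m {suc n} _ = ∣m⇒∣m*n (m ^ n) ∣-refl

%-≡-+⇒∣ : ∀ p .{{_ : NonZero p}} a d → (a + d) % p ≡ a % p → p ∣ d
%-≡-+⇒∣ p a d eq = ∣m+n∣m⇒∣n (divides ((a + d) / p) quotients) (divides (a / p) refl)
  where
  open ≡-Reasoning
  quotients : a / p * p + d ≡ (a + d) / p * p
  quotients = +-cancelˡ-≡ (a % p) _ _ (begin
    a % p + (a / p * p + d)        ≡⟨ +-assoc (a % p) _ d ⟨
    a % p + a / p * p + d          ≡⟨ cong (_+ d) (m≡m%n+[m/n]*n a p) ⟨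
    a + d                          ≡⟨ m≡m%n+[m/n]*n (a + d) p ⟩
    (a + d) % p + (a + d) / p * p  ≡⟨ cong (_+ (a + d) / p * p) eq ⟩
    a % p + (a + d) / p * p        ∎)

suc-%-≢ : ∀ p .{{_ : NonZero p}} → p ≢ 1 → ∀ x → suc x % p ≢ x % p
suc-%-≢ p p≢1 x eq = p≢1 (∣1⇒≡1 (%-≡-+⇒∣ p x 1 (trans (cong (_% p) (+-comm x 1)) eq)))

toℕ-mod-% : ∀ m n d .{{_ : NonZero n}} .{{_ : NonZero d}} → d ∣ n → toℕ (m mod n) % d ≡ m % d
toℕ-mod-% m n d d∣n = trans (cong (_% d) (toℕ-fromℕ< (m%n<n m n))) (m∣n⇒o%n%m≡o%m d n m d∣n)

three-in-two : ∀ {a} {X : Set a} {x y z A B : X} →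
  x ≡ A ⊎ x ≡ B → y ≡ A ⊎ y ≡ B → z ≡ A ⊎ z ≡ B → x ≡ y ⊎ y ≡ z ⊎ x ≡ z
three-in-two (inj₁ x≡A) (inj₁ y≡A) _          = inj₁ (trans x≡A (sym y≡A))
three-in-two (inj₂ x≡B) (inj₂ y≡B) _          = inj₁ (trans x≡B (sym y≡B))
three-in-two (inj₁ x≡A) (inj₂ y≡B) (inj₁ z≡A) = inj₂ (inj₂ (trans x≡A (sym z≡A)))
three-in-two (inj₁ x≡A) (inj₂ y≡B) (inj₂ z≡B) = inj₂ (inj₁ (trans y≡B (sym z≡B)))
three-in-two (inj₂ x≡B) (inj₁ y≡A) (inj₁ z≡A) = inj₂ (inj₁ (trans y≡A (sym z≡A)))
three-in-two (inj₂ x≡B) (inj₁ y≡A) (inj₂ z≡B) = inj₂ (inj₂ (trans x≡B (sym z≡B)))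

%2≡0⊎%2≡1 : ∀ x → x % 2 ≡ 0 ⊎ x % 2 ≡ 1
%2≡0⊎%2≡1 x with x % 2 | m%n<n x 2
... | 0 | _ = inj₁ refl
... | 1 | _ = inj₂ refl
... | suc (suc _) | s≤s (s≤s ())

%2-≢-≢⇒≡ : ∀ a b c → a % 2 ≢ c % 2 → b % 2 ≢ c % 2 → a % 2 ≡ b % 2
%2-≢-≢⇒≡ a b c a≢c b≢c with three-in-two (%2≡0⊎%2≡1 a) (%2≡0⊎%2≡1 b) (%2≡0⊎%2≡1 c)
... | inj₁ a≡b        = a≡b
... | inj₂ (inj₁ b≡c) = contradiction b≡c b≢c
... | inj₂ (inj₂ a≡c) = contradiction a≡c a≢c

%2-≢⇒≡suc : ∀ a b → a % 2 ≢ b % 2 → a % 2 ≡ suc b % 2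
%2-≢⇒≡suc a b a≢b = %2-≢-≢⇒≡ a (suc b) b a≢b (suc-%-≢ 2 (λ ()) b)

suc-%2-injective : ∀ a b → suc a % 2 ≡ suc b % 2 → a % 2 ≡ b % 2
suc-%2-injective a b eq =
  %2-≢-≢⇒≡ a b (suc a) (≢-sym (suc-%-≢ 2 (λ ()) a)) (λ b≡sa → suc-%-≢ 2 (λ ()) b (trans (sym eq) (sym b≡sa)))

avoids? : ∀ x A B → (x ≡ A ⊎ x ≡ B) ⊎ (x ≢ A × x ≢ B)
avoids? x A B with x ≟ A | x ≟ B
... | yes x≡A | _       = inj₁ (inj₁ x≡A)
... | no _    | yes x≡B = inj₁ (inj₂ x≡B)
... | no x≢A  | no x≢B  = inj₂ (x≢A , x≢B)

avoid-two-residues : ∀ p .{{_ : NonZero p}} → Prime p → ¬ p ∣ 2 → ∀ a M A B → ¬ p ∣ M →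
  ∃ λ c → M ∣ c × (a + c) % p ≢ A × (a + c) % p ≢ B
avoid-two-residues p p-prime p∤2 a M A B p∤M
  with avoids? (a % p) A B | avoids? ((a + M) % p) A B | avoids? ((a + M + M) % p) A B
... | inj₂ avoid | _ | _ = 0 , M ∣0 , subst (λ x → x % p ≢ A × x % p ≢ B) (sym (+-identityʳ a)) avoid
... | _ | inj₂ avoid | _ = M , ∣-refl , avoid
... | _ | _ | inj₂ avoid = M + M , ∣m∣n⇒∣m+n ∣-refl ∣-refl , subst (λ x → x % p ≢ A × x % p ≢ B) (+-assoc a M M) avoid
... | inj₁ h₀ | inj₁ h₁ | inj₁ h₂ with three-in-two h₀ h₁ h₂
...   | inj₁ r₀≡r₁        = contradiction (%-≡-+⇒∣ p a M (sym r₀≡r₁)) p∤M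
...   | inj₂ (inj₁ r₁≡r₂) = contradiction (%-≡-+⇒∣ p (a + M) M (sym r₁≡r₂)) p∤M
...   | inj₂ (inj₂ r₀≡r₂) = contradiction (subst (p ∣_) M+M≡2*M
        (%-≡-+⇒∣ p a (M + M) (trans (cong (_% p) (sym (+-assoc a M M))) (sym r₀≡r₂))))
        (prime∤* p-prime p∤2 p∤M)
  where M+M≡2*M = cong (M +_) (sym (+-identityʳ M))

subMod-% : ∀ n d .{{_ : NonZero d}} → d ∣ n → (v w : Fin n) → (toℕ w + subMod n v w) % d ≡ toℕ v % d
subMod-% n d d∣n v w with toℕ w ≤? toℕ v
... | yes w≤v = cong (_% d) (m+[n∸m]≡n w≤v)
... | no _    = trans (cong (_% d) (m+[n∸m]≡n (≤-trans (<⇒≤ (toℕ<n w)) (m≤m+n n (toℕ v)))))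
                      (%-remove-+ˡ (toℕ v) d∣n)

∣subMod⇒%≡ : ∀ n d .{{_ : NonZero d}} → d ∣ n → (v w : Fin n) → d ∣ subMod n v w → toℕ v % d ≡ toℕ w % d
∣subMod⇒%≡ n d d∣n v w d∣s = trans (sym (subMod-% n d d∣n v w)) (%-remove-+ʳ (toℕ w) d∣s)

%≡⇒∣subMod : ∀ n d .{{_ : NonZero d}} → d ∣ n → (v w : Fin n) → toℕ v % d ≡ toℕ w % d → d ∣ subMod n v w
%≡⇒∣subMod n d d∣n v w eq = %-≡-+⇒∣ d (toℕ w) (subMod n v w) (trans (subMod-% n d d∣n v w) eq)

coprime-subMod-suc : ∀ n .{{_ : NonZero n}} (v : Fin n) → Coprime (subMod n v (suc (toℕ v) mod n)) n
coprime-subMod-suc n v {d} (d∣s , d∣n) =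
  ∣1⇒≡1 (%-≡-+⇒∣ d (toℕ v) 1 (sym (begin
    toℕ v % d                    ≡⟨ ∣subMod⇒%≡ n d d∣n v _ d∣s ⟩
    toℕ (suc (toℕ v) mod n) % d  ≡⟨ toℕ-mod-% (suc (toℕ v)) n d d∣n ⟩
    suc (toℕ v) % d              ≡⟨ cong (_% d) (+-comm 1 (toℕ v)) ⟩
    (toℕ v + 1) % d              ∎)))
  where
  open ≡-Reasoning
  instance
    d≢0 : NonZero d
    d≢0 = ≢-nonZero λ { refl → ≢-nonZero⁻¹ n (0∣⇒≡0 d∣n) }

CommonUnitNeighbour : (n : ℕ) → Fin n → Fin n → Set
CommonUnitNeighbour n v v' = Σ (Fin n) λ w → InPhi n (subMod n v w) × InPhi n (subMod n w v')

module EvenUnitaryCayley (n : ℕ) .{{_ : NonZero n}} (2∣n : 2 ∣ n) where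

  Γ : Graph
  Γ = UnitaryCayley 2 n

  flip : Fin 2 → Fin 2
  flip zero       = suc zero
  flip (suc zero) = zero

  φ₂-flip : ∀ u → InPhi 2 (subMod 2 u (flip u)) × InPhi 2 (subMod 2 (flip u) u)
  φ₂-flip zero       = 1-coprimeTo 2 , 1-coprimeTo 2
  φ₂-flip (suc zero) = 1-coprimeTo 2 , 1-coprimeTo 2

  φ-parity-≢ : ∀ m (v v' : Fin m) → 2 ∣ m → InPhi m (subMod m v v') → toℕ v % 2 ≢ toℕ v' % 2
  φ-parity-≢ m v v' 2∣m v-v'∈φ v≡v' = contradiction (v-v'∈φ (%≡⇒∣subMod m 2 2∣m v v' v≡v' , 2∣m)) (λ ())

  ¬adj-same-side : ∀ u {v v'} → ¬ Adj Γ (u , v) (u , v')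
  ¬adj-same-side u (u-u∈φ , _) = φ-parity-≢ 2 u u ∣-refl u-u∈φ refl

  -- Its two level sets are the connected components of Γ.
  component : V Γ → ℕ
  component (u , v) = (toℕ u + toℕ v) % 2

  adj⇒component≡ : ∀ {x y} → Adj Γ x y → component x ≡ component y
  adj⇒component≡ {zero , v} {zero , v'} x~y = contradiction x~y (¬adj-same-side zero {v} {v'})
  adj⇒component≡ {suc zero , v} {suc zero , v'} x~y = contradiction x~y (¬adj-same-side (suc zero) {v} {v'})
  adj⇒component≡ {zero , v} {suc zero , v'} (_ , v-v'∈φ) =
    %2-≢⇒≡suc (toℕ v) (toℕ v') (φ-parity-≢ n v v' 2∣n v-v'∈φ)
  adj⇒component≡ {suc zero , v} {zero , v'} (_ , v-v'∈φ) =
    sym (%2-≢⇒≡suc (toℕ v') (toℕ v) (≢-sym (φ-parity-≢ n v v' 2∣n v-v'∈φ)))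

  walk⇒component≡ : ∀ {k x y} → Walk Γ k x y → component x ≡ component y
  walk⇒component≡ here         = refl
  walk⇒component≡ (step {x = x} {y} x~y w) = trans (adj⇒component≡ {x} {y} x~y) (walk⇒component≡ w)

  walk-via-common : ∀ u {v v'} → CommonUnitNeighbour n v v' → Walk Γ 2 (u , v) (u , v')
  walk-via-common u (w , v-w∈φ , w-v'∈φ) =
    step (proj₁ (φ₂-flip u) , v-w∈φ) (step (proj₂ (φ₂-flip u) , w-v'∈φ) here)

  module _ (common : ∀ v v' → toℕ v % 2 ≡ toℕ v' % 2 → CommonUnitNeighbour n v v') where

    walk-across : ∀ u (v v' : Fin n) → toℕ v % 2 ≢ toℕ v' % 2 → Walk Γ 3 (u , v) (flip u , v')
    walk-across u v v' v≢v' =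
      step (proj₁ (φ₂-flip u) , coprime-subMod-suc n v)
           (walk-via-common (flip u) (common w v' w≡v'))
      where
      w = suc (toℕ v) mod n
      w≡v' : toℕ w % 2 ≡ toℕ v' % 2
      w≡v' = %2-≢-≢⇒≡ (toℕ w) (toℕ v') (toℕ v)
        (λ w≡v → suc-%-≢ 2 (λ ()) (toℕ v) (trans (sym (toℕ-mod-% (suc (toℕ v)) n 2 2∣n)) w≡v))
        (≢-sym v≢v')

    distance≤3 : (x y : V Γ) → Connected Γ x y → DistLe Γ x y 3
    distance≤3 (zero , v) (zero , v') (_ , w) =
      2 , s≤s (s≤s z≤n) , walk-via-common zero (common v v' (walk⇒component≡ w))
    distance≤3 (suc zero , v) (suc zero , v') (_ , w) =
      2 , s≤s (s≤s z≤n) ,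
      walk-via-common (suc zero) (common v v' (suc-%2-injective (toℕ v) (toℕ v') (walk⇒component≡ w)))
    distance≤3 (zero , v) (suc zero , v') (_ , w) =
      3 , ≤-refl ,
      walk-across zero v v' (λ v≡v' → suc-%-≢ 2 (λ ()) (toℕ v') (trans (sym (walk⇒component≡ w)) v≡v'))
    distance≤3 (suc zero , v) (zero , v') (_ , w) =
      3 , ≤-refl ,
      walk-across (suc zero) v v' (λ v≡v' → suc-%-≢ 2 (λ ()) (toℕ v) (trans (walk⇒component≡ w) (sym v≡v')))

    diameter≡3 : ∀ d → d ∣ n → d ≢ 1 → ¬ 2 ∣ d → HasDiameter Γ 3
    diameter≡3 d d∣n d≢1 2∤d =
      distance≤3 , (suc zero , v₁) , (zero , v₀) , (3 , walk-across (suc zero) v₁ v₀ v₁≢v₀) , no-shorter-walk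
      where
      instance
        d≢0 : NonZero d
        d≢0 = ≢-nonZero λ { refl → 2∤d (2 ∣0) }
      v₁ v₀ : Fin n
      v₁ = d mod n
      v₀ = 0 mod n
      v₁≢v₀ : toℕ v₁ % 2 ≢ toℕ v₀ % 2
      v₁≢v₀ eq = 2∤d (m%n≡0⇒n∣m d 2 (trans (sym (toℕ-mod-% d n 2 2∣n)) (trans eq (toℕ-mod-% 0 n 2 2∣n))))
      d∣v₁-v₀ : d ∣ subMod n v₁ v₀
      d∣v₁-v₀ = %≡⇒∣subMod n d d∣n v₁ v₀ (begin
        toℕ v₁ % d  ≡⟨ toℕ-mod-% d n d d∣n ⟩
        d % d       ≡⟨ n%n≡0 d ⟩
        0           ≡⟨ n∣m⇒m%n≡0 0 d (d ∣0) ⟨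
        0 % d       ≡⟨ toℕ-mod-% 0 n d d∣n ⟨
        toℕ v₀ % d  ∎)
        where open ≡-Reasoning
      no-shorter-walk : (k : ℕ) → k < 3 → ¬ Walk Γ k (suc zero , v₁) (zero , v₀)
      no-shorter-walk 0 _ ()
      no-shorter-walk 1 _ (step (_ , v₁-v₀∈φ) here) = d≢1 (v₁-v₀∈φ (d∣v₁-v₀ , d∣n))
      no-shorter-walk 2 _ (step {y = zero , w} _ (step x~y here)) = ¬adj-same-side zero {w} {v₀} x~y
      no-shorter-walk 2 _ (step {y = suc zero , w} x~y _) = ¬adj-same-side (suc zero) {v₁} {w} x~y
      no-shorter-walk (suc (suc (suc _))) (s≤s (s≤s (s≤s ())))

module TwoOddPrimeFactors (q r α β γ : ℕ) (q-prime : Prime q) (r-prime : Prime r) (2∤q : ¬ 2 ∣ q) (2∤r : ¬ 2 ∣ r) (q≢r : q ≢ r)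
         (1≤α : 1 ≤ α) (1≤β : 1 ≤ β) (1≤γ : 1 ≤ γ) where

  n : ℕ
  n = 2 ^ α * q ^ β * r ^ γ

  instance
    q≢0 : NonZero q
    q≢0 = prime⇒nonZero q-prime
    r≢0 : NonZero r
    r≢0 = prime⇒nonZero r-prime
    n≢0 : NonZero n
    n≢0 = m*n≢0 (2 ^ α * q ^ β) (r ^ γ) {{m*n≢0 (2 ^ α) (q ^ β) {{m^n≢0 2 α}} {{m^n≢0 q β}}}} {{m^n≢0 r γ}}

  2∣n : 2 ∣ n
  2∣n = ∣m⇒∣m*n (r ^ γ) (∣m⇒∣m*n (q ^ β) (m∣m^n 2 1≤α))

  q∣n : q ∣ n
  q∣n = ∣m⇒∣m*n (r ^ γ) (∣n⇒∣m*n (2 ^ α) (m∣m^n q 1≤β))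

  private
    r∣n : r ∣ n
    r∣n = ∣n⇒∣m*n (2 ^ α * q ^ β) (m∣m^n r 1≤γ)

    q∤2^αr^γ : ¬ q ∣ 2 ^ α * r ^ γ
    q∤2^αr^γ = prime∤* q-prime (prime∤^ α q-prime (odd-prime∤2 q-prime 2∤q))
                               (prime∤^ γ q-prime (prime∤prime q-prime r-prime q≢r))
    r∤2^αq^β : ¬ r ∣ 2 ^ α * q ^ β
    r∤2^αq^β = prime∤* r-prime (prime∤^ α r-prime (odd-prime∤2 r-prime 2∤r))
                               (prime∤^ β r-prime (prime∤prime r-prime q-prime (q≢r ∘ sym)))

    φ-subMod : (v w : Fin n) →
      toℕ v % 2 ≢ toℕ w % 2 → toℕ v % q ≢ toℕ w % q → toℕ v % r ≢ toℕ w % r → InPhi n (subMod n v w)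
    φ-subMod v w v≢w₂ v≢w_q v≢w_r = coprime-*ʳ (coprime-*ʳ
      (coprime-^ʳ α (∤⇒coprime prime[2] (v≢w₂ ∘ ∣subMod⇒%≡ n 2 2∣n v w)))
      (coprime-^ʳ β (∤⇒coprime q-prime (v≢w_q ∘ ∣subMod⇒%≡ n q q∣n v w))))
      (coprime-^ʳ γ (∤⇒coprime r-prime (v≢w_r ∘ ∣subMod⇒%≡ n r r∣n v w)))

  -- w ≡ v + 1 (mod 2), while w mod q and w mod r avoid the residues of both v and v'; the two
  -- offsets are multiples of 2^α r^γ and 2^α q^β, so each is invisible to the other two primes.
  common-unit-neighbour : ∀ v v' → toℕ v % 2 ≡ toℕ v' % 2 → CommonUnitNeighbour n v v'
  common-unit-neighbour v v' v≡v'₂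
    with avoid-two-residues q q-prime (odd-prime∤2 q-prime 2∤q) (suc (toℕ v)) (2 ^ α * r ^ γ)
                            (toℕ v % q) (toℕ v' % q) q∤2^αr^γ
  ... | c , 2^αr^γ∣c , y≢v , y≢v'
    with avoid-two-residues r r-prime (odd-prime∤2 r-prime 2∤r) (suc (toℕ v) + c) (2 ^ α * q ^ β)
                            (toℕ v % r) (toℕ v' % r) r∤2^αq^β
  ... | d , 2^αq^β∣d , z≢v , z≢v' =
    w , φ-subMod v w (λ e → suc-%-≢ 2 (λ ()) (toℕ v) (trans (sym w≡1+v) (sym e)))
                     (λ e → y≢v (trans (sym w≡y) (sym e)))
                     (λ e → z≢v (trans (sym w≡z) (sym e)))
      , φ-subMod w v' (λ e → suc-%-≢ 2 (λ ()) (toℕ v) (trans (sym w≡1+v) (trans e (sym v≡v'₂))))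
                      (λ e → y≢v' (trans (sym w≡y) e))
                      (λ e → z≢v' (trans (sym w≡z) e))
    where
    y z : ℕ
    y = suc (toℕ v) + c
    z = y + d
    w : Fin n
    w = z mod n
    w≡1+v : toℕ w % 2 ≡ suc (toℕ v) % 2
    w≡1+v = trans (toℕ-mod-% z n 2 2∣n) (trans
      (%-remove-+ʳ y (∣-trans (∣m⇒∣m*n (q ^ β) (m∣m^n 2 1≤α)) 2^αq^β∣d))
      (%-remove-+ʳ (suc (toℕ v)) (∣-trans (∣m⇒∣m*n (r ^ γ) (m∣m^n 2 1≤α)) 2^αr^γ∣c)))
    w≡y : toℕ w % q ≡ y % q
    w≡y = trans (toℕ-mod-% z n q q∣n) (%-remove-+ʳ y (∣-trans (∣n⇒∣m*n (2 ^ α) (m∣m^n q 1≤β)) 2^αq^β∣d))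
    w≡z : toℕ w % r ≡ z % r
    w≡z = toℕ-mod-% z n r r∣n

lemma4p1 : (q r α β γ : ℕ) → Prime q → Prime r → ¬ (2 ∣ q) → ¬ (2 ∣ r) → q ≢ r →
    1 ≤ α → 1 ≤ β → 1 ≤ γ →
    HasDiameter (UnitaryCayley 2 (2 ^ α * q ^ β * r ^ γ)) 3
lemma4p1 q r α β γ q-prime r-prime 2∤q 2∤r q≢r 1≤α 1≤β 1≤γ =
  diameter≡3 n 2∣n common-unit-neighbour q q∣n (prime≢1 q-prime) 2∤q
  where
  open EvenUnitaryCayley using (diameter≡3)
  open TwoOddPrimeFactors q r α β γ q-prime r-prime 2∤q 2∤r q≢r 1≤α 1≤β 1≤γ
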